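{- For $n\ge0$ let $a_n=m_1(\mathrm{Im}\mathcal B_2(n))$ and $Q_n=|\mathcal Q(n)|$. Then: (a) $\displaystyle\sum_{n\ge0}a_nq^n=q^2\prod_{i\ge0}(1+q^{2^i})^{i+3}$. (b) For $n\ge0$, $a_{n+2}=Q_n$. (c) For $n\ge0$, $\displaystyle a_{n+2}=\sum_{\lambda\in\mathcal B(n)}\prod_{i\ge0}\binom{i+3}{m_{2^i}(\lambda)}$.
   Context: A binary partition is a partition (weakly decreasing sequence of positive integers) all of whose parts are powers of $2$ (including $1$). $\mathcal B(n)$ is the set of binary partitions of $n$ ($\mathcal B(0)$ contains only the empty partition); $\mathcal B_2(n)$ is the set of those with at least two parts. For $\lambda=(\lambda_1,\dots,\lambda_\ell)$ with $\ell\ge2$, $\mathrm{pre}_2(\lambda)$ is the partition whose parts are the products $\lambda_i\lambda_j$, $1\le i<j\le\ell$; $\mathrm{Im}\mathcal B_2(n)=\{\mathrm{pre}_2(\lambda):\lambda\in\mathcal B_2(n)\}$. $m_i(\mu)$ is the number of parts of $\mu$ equal to $i$, and $m_i(S)=\sum_{\mu\in S}m_i(\mu)$ for a set $S$ of partitions. An $(n+3)$-color binary partition uses parts of the form $2^t$ ($t\ge0$), where a part of size $2^t$ comes in $t+3$ colors $2^t_1,\dots,2^t_{t+3}$ (colored parts are distinct objects). $\mathcal Q(m)$ is the set of such color binary partitions of $m$ into distinct colored parts, i.e. sets of distinct colored parts whose sizes sum to $m$; e.g. $|\mathcal Q(4)|=23$. -}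

module Defs where

open import Data.Nat using (ℕ; zero; suc; _+_; _*_; _∸_; _^_; _≤?_; _≤ᵇ_)
open import Data.Bool using (if_then_else_; _∧_)
open import Data.Nat.ListAction using (sum; product)
open import Data.Nat.Properties using (_≟_)
open import Data.Nat.Combinatorics using (_C_)
open import Data.List using (List; []; _∷_; [_]; _++_; map; filter; length; upTo; reverse; concatMap; deduplicate; replicate)
open import Data.List.Properties using (≡-dec)
open import Data.Product using (_×_; _,_; proj₁)
open import Relation.Nullary using (yes; no)

-- A partition is represented as a weakly decreasing list of positive parts.
Partition : Set
Partition = List ℕ

powersUpTo : ℕ → List ℕ
powersUpTo n = reverse (filter (_≤? n) (map (2 ^_) (upTo (suc n))))

-- bparts fuel n ps : all weakly decreasing lists of parts taken from the
-- (decreasing) list ps, summing to n.  fuel ≥ n suffices (every part ≥ 1).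
bparts : ℕ → ℕ → List ℕ → List Partition
bparts _ zero _ = [ [] ]
bparts zero (suc n) _ = []
bparts (suc f) (suc n) [] = []
bparts (suc f) (suc n) (p ∷ ps) =
  (if (p ≤ᵇ suc n) ∧ (1 ≤ᵇ p) then map (p ∷_) (bparts f (suc n ∸ p) (p ∷ ps)) else [])
  ++ bparts (suc f) (suc n) ps

𝓑 : ℕ → List Partition
𝓑 n = bparts n n (powersUpTo n)

𝓑₂ : ℕ → List Partition
𝓑₂ n = filter (λ l → 2 ≤? length l) (𝓑 n)

pairProducts : List ℕ → List ℕ
pairProducts [] = []
pairProducts (x ∷ xs) = map (x *_) xs ++ pairProducts xs

insertDesc : ℕ → List ℕ → List ℕ
insertDesc x [] = [ x ]
insertDesc x (y ∷ ys) with y ≤? x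
... | yes _ = x ∷ y ∷ ys
... | no _  = y ∷ insertDesc x ys

sortDesc : List ℕ → List ℕ
sortDesc [] = []
sortDesc (x ∷ xs) = insertDesc x (sortDesc xs)

pre₂ : Partition → Partition
pre₂ λ′ = sortDesc (pairProducts λ′)

Im𝓑₂ : ℕ → List Partition
Im𝓑₂ n = deduplicate (≡-dec _≟_) (map pre₂ (𝓑₂ n))

mult : ℕ → Partition → ℕ
mult i [] = 0
mult i (x ∷ xs) with x ≟ i
... | yes _ = suc (mult i xs)
... | no _  = mult i xs

multSet : ℕ → List Partition → ℕ
multSet i S = sum (map (mult i) S)

a : ℕ → ℕ
a n = multSet 1 (Im𝓑₂ n)

-- a coloured part (t , c) is the part 2^t in colour c+1, with c < t+3
ColouredPart : Set
ColouredPart = ℕ × ℕ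

size : ColouredPart → ℕ
size (t , _) = 2 ^ t

-- all coloured parts of size 2^t ≤ m (t ≤ m suffices since 2^t > t); larger parts cannot occur
colouredParts : ℕ → List ColouredPart
colouredParts m = concatMap (λ t → map (t ,_) (upTo (t + 3))) (filter (λ t → 2 ^ t ≤? m) (upTo (suc m)))

subsets : {A : Set} → List A → List (List A)
subsets [] = [ [] ]
subsets (x ∷ xs) = map (x ∷_) (subsets xs) ++ subsets xs

𝓠 : ℕ → List (List ColouredPart)
𝓠 m = filter (λ s → sum (map size s) ≟ m) (subsets (colouredParts m))

Q : ℕ → ℕ
Q m = length (𝓠 m)

-- Polynomials (coefficient lists, lowest degree first)

Poly : Set
Poly = List ℕ

_⊕_ : Poly → Poly → Poly
[] ⊕ q = q
(x ∷ p) ⊕ [] = x ∷ p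
(x ∷ p) ⊕ (y ∷ q) = (x + y) ∷ (p ⊕ q)

_⊛_ : Poly → Poly → Poly
[] ⊛ q = []
(x ∷ p) ⊛ q = map (x *_) q ⊕ (0 ∷ (p ⊛ q))

_^ₚ_ : Poly → ℕ → Poly
p ^ₚ zero = [ 1 ]
p ^ₚ suc k = p ⊛ (p ^ₚ k)

monomial : ℕ → Poly
monomial k = replicate k 0 ++ [ 1 ]

coeff : ℕ → Poly → ℕ
coeff _ [] = 0
coeff zero (x ∷ _) = x
coeff (suc n) (_ ∷ p) = coeff n p

prodUpTo : ℕ → Poly
prodUpTo zero = [ 1 ]
prodUpTo (suc N) = prodUpTo N ⊛ (([ 1 ] ⊕ monomial (2 ^ N)) ^ₚ (N + 3))

genTrunc : ℕ → Poly
genTrunc N = monomial 2 ⊛ prodUpTo N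

-- ∑_{λ ∈ 𝓑(n)} ∏_{i ≥ 0} C(i+3, m_{2^i}(λ))   (factors with 2^i > n equal 1)

binomSum : ℕ → ℕ
binomSum n = sum (map (λ l → product (map (λ i → (i + 3) C mult (2 ^ i) l) (upTo (suc n)))) (𝓑 n))

-- Coefficient sequences ℕ → ℕ stand for formal power series in q; multiplication by q^a, by
-- 1 + q^a and by 1/(1 - q^p) are additive operators commuting with shifts, hence with each other.
-- Splitting off the largest part size of a binary partition turns Σ_λ w(λ) q^|λ|, for a weight w
-- that is a product over part sizes, into a product of one series per size 2^t.
-- (c) For w(λ) = ∏_t C(t+3, m_{2^t}(λ)) the factor for 2^t is (1 + q^(2^t))^(t+3).
-- (b) Each coloured part of size 2^t contributes a factor 1 + q^(2^t).
-- (a) m_1(pre₂ λ) = C(m_1(λ), 2), and pre₂ is injective on binary partitions with at least two 1s,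
--     so a_n is the coefficient of q^n in q² (1-q)⁻³ ∏_{t≥1} (1-q^(2^t))⁻¹; the identity
--     (1 + x)/(1 - x²) = 1/(1 - x) telescopes this into q² ∏_t (1 + q^(2^t))^(t+3).
-- Factors with 2^t > n do not affect the coefficient of q^n, so finite products suffice.

module Submission where

open import Defs

open import Data.Bool using (true; false)
open import Data.Empty using (⊥-elim)
open import Data.List
  using (List; []; _∷_; [_]; _++_; foldr; map; filter; length; upTo; downFrom; applyUpTo; applyDownFrom;
         concatMap; replicate; reverse; deduplicate)
open import Data.List.Properties
  using (map-id; map-cong; map-cong-local; map-++; map-∘; map-upTo; foldr-++; filter-++; filter-≐;
         filter-accept; filter-reject; length-++; length-upTo; upTo-∷ʳ; unfold-reverse; reverse-applyUpTo;
         ++-identityʳ; ∷-injectiveʳ; ≡-dec)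
open import Data.List.Membership.Propositional using (_∈_)
open import Data.List.Membership.Propositional.Properties
  using (∈-++⁻; ∈-map⁻; ∈-filter⁻; ∈-upTo⁺; ∈-applyDownFrom⁻; ∈-deduplicate⁻)
open import Data.List.Relation.Binary.Disjoint.Propositional using (Disjoint)
open import Data.List.Relation.Unary.All as All using (All; []; _∷_)
open import Data.List.Relation.Unary.All.Properties using (all-filter; replicate⁺; map⁺)
open import Data.List.Relation.Unary.AllPairs using (AllPairs; []; _∷_)
import Data.List.Relation.Unary.AllPairs.Properties as AllPairs
open import Data.List.Relation.Unary.Any using (here; there)
open import Data.List.Relation.Unary.Unique.Propositional using (Unique)
import Data.List.Relation.Unary.Unique.Propositional.Properties as Unique
open import Data.Nat
  using (ℕ; zero; suc; _+_; _*_; _∸_; _^_; _≤_; _<_; _≥_; _>_; _≤?_; _<?_; _<ᵇ_; z≤n; s≤s; >-nonZero)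
open import Data.Nat.Combinatorics using (_C_; nC1≡n; k>n⇒nCk≡0; nCk+nC[k+1]≡[n+1]C[k+1])
open import Data.Nat.GeneralisedArithmetic using (fold)
open import Data.Nat.Induction using (<-rec)
open import Data.Nat.ListAction using (sum; product)
open import Data.Nat.ListAction.Properties using (sum-++)
open import Data.Nat.Logarithm using (⌊log₂_⌋; ⌊log₂[2^n]⌋≡n)
open import Data.Nat.Properties
open import Algebra.Properties.CommutativeSemigroup +-commutativeSemigroup using (interchange; x∙yz≈y∙xz)
import Algebra.Properties.CommutativeSemigroup *-commutativeSemigroup as *
open import Data.Product using (_×_; _,_; proj₁; proj₂)
open import Data.Sum using (_⊎_; inj₁; inj₂)
open import Function using (_∘_)
open import Relation.Binary.Definitions using (DecidableEquality; tri<; tri≈; tri>)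
open import Relation.Binary.PropositionalEquality hiding ([_])
open import Relation.Nullary using (¬_; yes; no; does; ¬?)
open import Relation.Nullary.Decidable using (decidable-stable)
open import Relation.Nullary.Reflects using (ofʸ; ofⁿ)
open import Relation.Unary using (Decidable)

-- A formal power series over ℕ, by its coefficients. shift a, onePlus a and geom p below are
-- multiplication by q^a, 1 + q^a and 1/(1 - q^p).
Series : Set
Series = ℕ → ℕ

infixl 6 _+ₛ_
infixl 7 _·ₛ_

_+ₛ_ : Series → Series → Series
(f +ₛ g) n = f n + g n

_·ₛ_ : ℕ → Series → Series
(c ·ₛ f) n = c * f n

0ₛ : Series
0ₛ _ = 0

δ : Series
δ zero = 1
δ (suc _) = 0

shift : ℕ → Series → Series
shift zero f n = f n
shift (suc a) f zero = 0
shift (suc a) f (suc n) = shift a f n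

shift-cong : ∀ a {f g} → f ≗ g → shift a f ≗ shift a g
shift-cong zero f≗g n = f≗g n
shift-cong (suc a) f≗g zero = refl
shift-cong (suc a) f≗g (suc n) = shift-cong a f≗g n

shift-≥ : ∀ a f {n} → a ≤ n → shift a f n ≡ f (n ∸ a)
shift-≥ zero f _ = refl
shift-≥ (suc a) f (s≤s a≤n) = shift-≥ a f a≤n

shift-< : ∀ a f {n} → n < a → shift a f n ≡ 0
shift-< (suc a) f {zero} _ = refl
shift-< (suc a) f {suc n} (s≤s n<a) = shift-< a f n<a

shift-+ₛ : ∀ a f g → shift a (f +ₛ g) ≗ shift a f +ₛ shift a g
shift-+ₛ zero f g n = refl
shift-+ₛ (suc a) f g zero = refl
shift-+ₛ (suc a) f g (suc n) = shift-+ₛ a f g n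

shift-·ₛ : ∀ a c f → shift a (c ·ₛ f) ≗ c ·ₛ shift a f
shift-·ₛ zero c f n = refl
shift-·ₛ (suc a) c f zero = sym (*-zeroʳ c)
shift-·ₛ (suc a) c f (suc n) = shift-·ₛ a c f n

shift-0ₛ : ∀ a → shift a 0ₛ ≗ 0ₛ
shift-0ₛ zero n = refl
shift-0ₛ (suc a) zero = refl
shift-0ₛ (suc a) (suc n) = shift-0ₛ a n

shift-shift : ∀ a b f → shift a (shift b f) ≗ shift (a + b) f
shift-shift zero b f n = refl
shift-shift (suc a) b f zero = refl
shift-shift (suc a) b f (suc n) = shift-shift a b f n

shift-comm : ∀ a b f → shift a (shift b f) ≗ shift b (shift a f)
shift-comm a b f n = begin
  shift a (shift b f) n ≡⟨ shift-shift a b f n ⟩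
  shift (a + b) f n     ≡⟨ cong (λ c → shift c f n) (+-comm a b) ⟩
  shift (b + a) f n     ≡⟨ shift-shift b a f n ⟨
  shift b (shift a f) n ∎
  where open ≡-Reasoning

shift-below : ∀ {p f g n} → 1 ≤ p → (∀ {m} → m < n → f m ≡ g m) → shift p f n ≡ shift p g n
shift-below {p} {f} {g} {n} p>0 f≡g with p ≤? n
... | yes p≤n =
  trans (shift-≥ p f p≤n) (trans (f≡g (∸-monoʳ-< p>0 p≤n)) (sym (shift-≥ p g p≤n)))
... | no p≰n = trans (shift-< p f (≰⇒> p≰n)) (sym (shift-< p g (≰⇒> p≰n)))

record IsShiftInvariant (L : Series → Series) : Set where
  field
    ≗-cong     : ∀ {f g} → f ≗ g → L f ≗ L g
    +ₛ-homo    : ∀ f g → L (f +ₛ g) ≗ L f +ₛ L g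
    shift-homo : ∀ a f → L (shift a f) ≗ shift a (L f)

open IsShiftInvariant

id-isSI : IsShiftInvariant (λ f → f)
id-isSI = record
  { ≗-cong     = λ f≗g → f≗g
  ; +ₛ-homo    = λ _ _ _ → refl
  ; shift-homo = λ _ _ _ → refl
  }

∘-isSI : ∀ {L M : Series → Series} →
  IsShiftInvariant L → IsShiftInvariant M → IsShiftInvariant (L ∘ M)
∘-isSI {M = M} isL isM = record
  { ≗-cong     = ≗-cong isL ∘ ≗-cong isM
  ; +ₛ-homo    = λ f g n → trans (≗-cong isL (+ₛ-homo isM f g) n) (+ₛ-homo isL (M f) (M g) n)
  ; shift-homo = λ a f n → trans (≗-cong isL (shift-homo isM a f) n) (shift-homo isL a (M f) n)
  }

fold-isSI : ∀ {M : Series → Series} →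
  IsShiftInvariant M → ∀ k → IsShiftInvariant (λ f → fold f M k)
fold-isSI isM zero = id-isSI
fold-isSI isM (suc k) = ∘-isSI isM (fold-isSI isM k)

shift-isSI : ∀ a → IsShiftInvariant (shift a)
shift-isSI a = record
  { ≗-cong     = shift-cong a
  ; +ₛ-homo    = shift-+ₛ a
  ; shift-homo = λ b f → shift-comm a b f
  }

onePlus : ℕ → Series → Series
onePlus a f = f +ₛ shift a f

onePlus-isSI : ∀ a → IsShiftInvariant (onePlus a)
onePlus-isSI a = record
  { ≗-cong     = λ f≗g n → cong₂ _+_ (f≗g n) (shift-cong a f≗g n)
  ; +ₛ-homo    = λ f g n → trans (cong (f n + g n +_) (shift-+ₛ a f g n)) (interchange (f n) (g n) _ _)
  ; shift-homo = λ b f n →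
      sym (trans (shift-+ₛ b f (shift a f) n) (cong (shift b f n +_) (shift-comm b a f n)))
  }

onePlus-comm : ∀ {L : Series → Series} →
  IsShiftInvariant L → ∀ a f → L (onePlus a f) ≗ onePlus a (L f)
onePlus-comm {L} isL a f n =
  trans (+ₛ-homo isL f (shift a f) n) (cong (L f n +_) (shift-homo isL a f n))

fold-comm : ∀ {L M : Series → Series} → IsShiftInvariant M →
  (∀ f → L (M f) ≗ M (L f)) → ∀ k f → L (fold f M k) ≗ fold (L f) M k
fold-comm isM L∘M≗M∘L zero f n = refl
fold-comm {L} {M} isM L∘M≗M∘L (suc k) f n =
  trans (L∘M≗M∘L (fold f M k) n) (≗-cong isM (fold-comm {L} isM L∘M≗M∘L k f) n)

fold-onePlus-small : ∀ {a n} f k → n < a → fold f (onePlus a) k n ≡ f n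
fold-onePlus-small f zero n<a = refl
fold-onePlus-small {a} f (suc k) n<a =
  trans (cong₂ _+_ (fold-onePlus-small f k n<a) (shift-< a _ n<a)) (+-identityʳ _)

-- Recurrences and the geometric series

recurrence-unique : ∀ {p} → 1 ≤ p → {F X Y : ℕ → Series} →
  (∀ j → X j ≗ F j +ₛ shift p (X (suc j))) →
  (∀ j → Y j ≗ F j +ₛ shift p (Y (suc j))) →
  ∀ j → X j ≗ Y j
recurrence-unique p>0 {F} {X} {Y} X-rec Y-rec j n = <-rec (λ n → ∀ j → X j n ≡ Y j n) step n j
  where
  step : ∀ n → (∀ {m} → m < n → ∀ j → X j m ≡ Y j m) → ∀ j → X j n ≡ Y j n
  step n ih j =
    trans (X-rec j n) (trans (cong (F j n +_) (shift-below p>0 (λ m<n → ih m<n (suc j)))) (sym (Y-rec j n)))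

-- geomUpTo K p f = (1 + q^p + ⋯ + q^((K-1)p)) f is exact below degree K when p ≥ 1, which is how
-- geom uses it; for p = 0, geom p is junk and every lemma about it assumes 1 ≤ p.
geomUpTo : ℕ → ℕ → Series → Series
geomUpTo zero p f = 0ₛ
geomUpTo (suc K) p f = f +ₛ shift p (geomUpTo K p f)

geom : ℕ → Series → Series
geom p f n = geomUpTo (suc n) p f n

geomUpTo-stable : ∀ {p f K L n} → 1 ≤ p → n < K → n < L → geomUpTo K p f n ≡ geomUpTo L p f n
geomUpTo-stable {f = f} {K = suc K} {L = suc L} {n = n} p>0 (s≤s n≤K) (s≤s n≤L) =
  cong (f n +_) (shift-below p>0 (λ m<n →
    geomUpTo-stable p>0 (<-≤-trans m<n n≤K) (<-≤-trans m<n n≤L)))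

geom-unfold : ∀ {p} → 1 ≤ p → ∀ f → geom p f ≗ f +ₛ shift p (geom p f)
geom-unfold p>0 f n = cong (f n +_) (shift-below p>0 (λ {m} m<n → geomUpTo-stable p>0 m<n (n<1+n m)))

geom-unique : ∀ {p} → 1 ≤ p → ∀ {f X} → X ≗ f +ₛ shift p X → X ≗ geom p f
geom-unique {p} p>0 {f} {X} X-rec =
  recurrence-unique p>0 {F = λ _ → f} {X = λ _ → X} {Y = λ _ → geom p f}
    (λ _ → X-rec) (λ _ → geom-unfold p>0 f) 0

geom-isSI : ∀ {p} → 1 ≤ p → IsShiftInvariant (geom p)
geom-isSI {p} p>0 = record
  { ≗-cong     = λ {f} f≗g → geom-unique p>0 (λ n →
      trans (geom-unfold p>0 f n) (cong (_+ _) (f≗g n)))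
  ; +ₛ-homo    = λ f g n → sym (geom-unique p>0 (λ n →
      trans (cong₂ _+_ (geom-unfold p>0 f n) (geom-unfold p>0 g n))
      (trans (interchange (f n) _ (g n) _)
             (cong (f n + g n +_) (sym (shift-+ₛ p (geom p f) (geom p g) n))))) n)
  ; shift-homo = λ a f n → sym (geom-unique p>0 (λ n →
      trans (shift-cong a (geom-unfold p>0 f) n)
      (trans (shift-+ₛ a f _ n) (cong (shift a f n +_) (shift-comm a p (geom p f) n)))) n)
  }

geom-comm : ∀ {p} {L : Series → Series} → 1 ≤ p →
  IsShiftInvariant L → ∀ f → L (geom p f) ≗ geom p (L f)
geom-comm {p} {L} p>0 isL f = geom-unique p>0 (λ n →
  trans (≗-cong isL (geom-unfold p>0 f) n)
  (trans (+ₛ-homo isL f _ n) (cong (L f n +_) (shift-homo isL p (geom p f) n))))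

fold-geom-small : ∀ {p n} f k → n < p → fold f (geom p) k n ≡ f n
fold-geom-small f zero n<p = refl
fold-geom-small {p} f (suc k) n<p = trans (geom-unfold (≤-<-trans z≤n n<p) (fold f (geom p) k) _)
  (trans (cong₂ _+_ (fold-geom-small f k n<p) (shift-< p _ n<p)) (+-identityʳ _))

-- (1 + x)/(1 - x²) = 1/(1 - x): the identity that makes the product telescope.
onePlus-geom : ∀ {p} → 1 ≤ p → ∀ f → onePlus p (geom (2 * p) f) ≗ geom p f
onePlus-geom {p} p>0 f = geom-unique p>0 (λ n → begin
  G n + shift p G n
    ≡⟨ cong (_+ shift p G n) (geom-unfold 2p>0 f n) ⟩
  f n + shift (2 * p) G n + shift p G n
    ≡⟨ cong (λ q → f n + q + shift p G n) (sym (shift-twice p G n)) ⟩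
  f n + shift p (shift p G) n + shift p G n
    ≡⟨ +-assoc (f n) _ _ ⟩
  f n + (shift p (shift p G) n + shift p G n)
    ≡⟨ cong (f n +_) (+-comm _ (shift p G n)) ⟩
  f n + (shift p G n + shift p (shift p G) n)
    ≡⟨ cong (f n +_) (shift-+ₛ p G (shift p G) n) ⟨
  f n + shift p (onePlus p G) n ∎)
  where
  open ≡-Reasoning
  G = geom (2 * p) f
  shift-twice : ∀ p f → shift p (shift p f) ≗ shift (2 * p) f
  shift-twice p f n =
    trans (shift-shift p p f n) (cong (λ c → shift (p + c) f n) (sym (+-identityʳ p)))
  2p>0 : 1 ≤ 2 * p
  2p>0 = ≤-trans p>0 (m≤m+n p _)

fold-onePlus-geom : ∀ {p} → 1 ≤ p → ∀ k f →
  fold (fold f (geom (2 * p)) k) (onePlus p) k ≗ fold f (geom p) k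
fold-onePlus-geom p>0 zero f n = refl
fold-onePlus-geom {p} p>0 (suc k) f n = begin
  onePlus p (Eᵏ (geom (2 * p) (fold f (geom (2 * p)) k))) n
    ≡⟨ ≗-cong (onePlus-isSI p) (geom-comm 2p>0 (fold-isSI (onePlus-isSI p) k) _) n ⟩
  onePlus p (geom (2 * p) (Eᵏ (fold f (geom (2 * p)) k))) n
    ≡⟨ onePlus-geom p>0 _ n ⟩
  geom p (Eᵏ (fold f (geom (2 * p)) k)) n
    ≡⟨ ≗-cong (geom-isSI p>0) (fold-onePlus-geom p>0 k f) n ⟩
  geom p (fold f (geom p) k) n ∎
  where
  open ≡-Reasoning
  Eᵏ = λ g → fold g (onePlus p) k
  2p>0 : 1 ≤ 2 * p
  2p>0 = ≤-trans p>0 (m≤m+n p _)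

-- binomialShifts p W c j = Σₖ C(c, j+k) q^(kp) W, defined through Pascal's rule.
binomialShifts : ℕ → Series → ℕ → ℕ → Series
binomialShifts p W c zero = fold W (onePlus p) c
binomialShifts p W zero (suc j) = 0ₛ
binomialShifts p W (suc c) (suc j) = binomialShifts p W c j +ₛ binomialShifts p W c (suc j)

binomialShifts-rec : ∀ p W c j →
  binomialShifts p W c j ≗ (c C j) ·ₛ W +ₛ shift p (binomialShifts p W c (suc j))
binomialShifts-rec p W zero zero n =
  sym (trans (cong₂ _+_ (+-identityʳ (W n)) (shift-0ₛ p n)) (+-identityʳ (W n)))
binomialShifts-rec p W zero (suc j) n = sym (shift-0ₛ p n)
binomialShifts-rec p W (suc c) zero n = begin
  B c 0 n + shift p (B c 0) n
    ≡⟨ cong (_+ shift p (B c 0) n) (binomialShifts-rec p W c 0 n) ⟩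
  1 * W n + shift p (B c 1) n + shift p (B c 0) n
    ≡⟨ +-assoc (1 * W n) _ _ ⟩
  1 * W n + (shift p (B c 1) n + shift p (B c 0) n)
    ≡⟨ cong (1 * W n +_) (+-comm _ (shift p (B c 0) n)) ⟩
  1 * W n + (shift p (B c 0) n + shift p (B c 1) n)
    ≡⟨ cong (1 * W n +_) (shift-+ₛ p (B c 0) (B c 1) n) ⟨
  1 * W n + shift p (B c 0 +ₛ B c 1) n ∎
  where
  open ≡-Reasoning
  B = binomialShifts p W
binomialShifts-rec p W (suc c) (suc j) n = begin
  B c j n + B c (suc j) n
    ≡⟨ cong₂ _+_ (binomialShifts-rec p W c j n) (binomialShifts-rec p W c (suc j) n) ⟩
  ((c C j) * W n + shift p (B c (suc j)) n) + ((c C suc j) * W n + shift p (B c (2 + j)) n)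
    ≡⟨ interchange ((c C j) * W n) _ _ _ ⟩
  ((c C j) * W n + (c C suc j) * W n) + (shift p (B c (suc j)) n + shift p (B c (2 + j)) n)
    ≡⟨ cong₂ _+_ (sym (*-distribʳ-+ (W n) (c C j) _)) (sym (shift-+ₛ p (B c (suc j)) _ n)) ⟩
  (c C j + c C suc j) * W n + shift p (B c (suc j) +ₛ B c (2 + j)) n
    ≡⟨ cong (λ b → b * W n + shift p (B (suc c) (2 + j)) n) (nCk+nC[k+1]≡[n+1]C[k+1] c j) ⟩
  (suc c C suc j) * W n + shift p (B (suc c) (2 + j)) n ∎
  where
  open ≡-Reasoning
  B = binomialShifts p W

binomial-unique : ∀ {p} → 1 ≤ p → ∀ {c W} {V : ℕ → Series} →
  (∀ j → V j ≗ (c C j) ·ₛ W +ₛ shift p (V (suc j))) → V 0 ≗ fold W (onePlus p) c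
binomial-unique {p} p>0 {c} {W} V-rec = recurrence-unique p>0 V-rec (binomialShifts-rec p W c) 0

-- Products of (1 + q^(2^t))^(t+3)

binaryFactor : ℕ → Series → Series
binaryFactor t f = fold f (onePlus (2 ^ t)) (t + 3)

binaryProduct : List ℕ → Series → Series
binaryProduct ts f = foldr binaryFactor f ts

binaryFactor-isSI : ∀ t → IsShiftInvariant (binaryFactor t)
binaryFactor-isSI t = fold-isSI (onePlus-isSI (2 ^ t)) (t + 3)

binaryProduct-isSI : ∀ ts → IsShiftInvariant (binaryProduct ts)
binaryProduct-isSI [] = id-isSI
binaryProduct-isSI (t ∷ ts) = ∘-isSI (binaryFactor-isSI t) (binaryProduct-isSI ts)

binaryProduct-comm : ∀ {L : Series → Series} →
  IsShiftInvariant L → ∀ ts f → L (binaryProduct ts f) ≗ binaryProduct ts (L f)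
binaryProduct-comm isL [] f n = refl
binaryProduct-comm isL (t ∷ ts) f n =
  trans (fold-comm (onePlus-isSI (2 ^ t)) (onePlus-comm isL (2 ^ t)) (t + 3) (binaryProduct ts f) n)
        (≗-cong (binaryFactor-isSI t) (binaryProduct-comm isL ts f) n)

binaryProduct-small : ∀ {n} ts f → All (λ t → n < 2 ^ t) ts → binaryProduct ts f n ≡ f n
binaryProduct-small [] f [] = refl
binaryProduct-small (t ∷ ts) f (n<2^t ∷ ns) =
  trans (fold-onePlus-small _ (t + 3) n<2^t) (binaryProduct-small ts f ns)

binaryProduct-stable : ∀ {N M} g {k} → N ≤ M → k < 2 ^ N →
  binaryProduct (downFrom M) g k ≡ binaryProduct (downFrom N) g k
binaryProduct-stable g N≤M k<2^N with m≤n⇒m<n∨m≡n N≤M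
... | inj₂ refl = refl
... | inj₁ (s≤s {n = M} N≤M) =
  trans (fold-onePlus-small _ (M + 3) (<-≤-trans k<2^N (^-monoʳ-≤ 2 N≤M)))
        (binaryProduct-stable g N≤M k<2^N)

binaryProduct-partition : ∀ {P : ℕ → Set} (P? : Decidable P) ts f →
  binaryProduct ts f ≗ binaryProduct (filter (¬? ∘ P?) ts) (binaryProduct (filter P? ts) f)
binaryProduct-partition P? [] f n = refl
binaryProduct-partition P? (t ∷ ts) f n with P? t
... | yes _ = trans (≗-cong (binaryFactor-isSI t) (binaryProduct-partition P? ts f) n)
                    (binaryProduct-comm (binaryFactor-isSI t) (filter (¬? ∘ P?) ts) _ n)
... | no _ = ≗-cong (binaryFactor-isSI t) (binaryProduct-partition P? ts f) n

binaryProduct-upTo : ∀ N f → binaryProduct (upTo N) f ≗ binaryProduct (downFrom N) f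
binaryProduct-upTo zero f n = refl
binaryProduct-upTo (suc N) f n = begin
  binaryProduct (upTo (suc N)) f n            ≡⟨ cong (λ us → binaryProduct us f n) (sym (upTo-∷ʳ N)) ⟩
  binaryProduct (upTo N ++ [ N ]) f n         ≡⟨ cong (λ g → g n) (foldr-++ binaryFactor f (upTo N) [ N ]) ⟩
  binaryProduct (upTo N) (binaryFactor N f) n ≡⟨ binaryProduct-comm (binaryFactor-isSI N) (upTo N) f n ⟨
  binaryFactor N (binaryProduct (upTo N) f) n ≡⟨ ≗-cong (binaryFactor-isSI N) (binaryProduct-upTo N f) n ⟩
  binaryProduct (downFrom (suc N)) f n        ∎
  where open ≡-Reasoning

coeffs : Poly → Series
coeffs p n = coeff n p

polyMul : Poly → Series → Series
polyMul [] f = 0ₛ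
polyMul (x ∷ p) f = x ·ₛ f +ₛ shift 1 (polyMul p f)

coeffs-⊕ : ∀ p q → coeffs (p ⊕ q) ≗ coeffs p +ₛ coeffs q
coeffs-⊕ [] q n = refl
coeffs-⊕ (x ∷ p) [] n = sym (+-identityʳ _)
coeffs-⊕ (x ∷ p) (y ∷ q) zero = refl
coeffs-⊕ (x ∷ p) (y ∷ q) (suc n) = coeffs-⊕ p q n

coeffs-scale : ∀ x q → coeffs (map (x *_) q) ≗ x ·ₛ coeffs q
coeffs-scale x [] n = sym (*-zeroʳ x)
coeffs-scale x (y ∷ q) zero = refl
coeffs-scale x (y ∷ q) (suc n) = coeffs-scale x q n

coeffs-0∷ : ∀ p → coeffs (0 ∷ p) ≗ shift 1 (coeffs p)
coeffs-0∷ p zero = refl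
coeffs-0∷ p (suc n) = refl

coeffs-⊛ : ∀ p q → coeffs (p ⊛ q) ≗ polyMul p (coeffs q)
coeffs-⊛ [] q n = refl
coeffs-⊛ (x ∷ p) q n = trans (coeffs-⊕ (map (x *_) q) (0 ∷ (p ⊛ q)) n)
  (cong₂ _+_ (coeffs-scale x q n) (trans (coeffs-0∷ (p ⊛ q) n) (shift-cong 1 (coeffs-⊛ p q) n)))

polyMul-isSI : ∀ p → IsShiftInvariant (polyMul p)
polyMul-isSI [] = record
  { ≗-cong     = λ _ _ → refl
  ; +ₛ-homo    = λ _ _ _ → refl
  ; shift-homo = λ a _ n → sym (shift-0ₛ a n)
  }
polyMul-isSI (x ∷ p) = record
  { ≗-cong     = λ f≗g n → cong₂ _+_ (cong (x *_) (f≗g n)) (shift-cong 1 (≗-cong isP f≗g) n)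
  ; +ₛ-homo    = λ f g n → trans (cong₂ _+_ (*-distribˡ-+ x (f n) (g n))
                   (trans (shift-cong 1 (+ₛ-homo isP f g) n) (shift-+ₛ 1 (polyMul p f) (polyMul p g) n)))
                   (interchange (x * f n) _ _ _)
  ; shift-homo = λ a f n → sym (trans (shift-+ₛ a (x ·ₛ f) _ n) (cong₂ _+_ (shift-·ₛ a x f n)
                   (trans (shift-comm a 1 (polyMul p f) n) (shift-cong 1 (λ m → sym (shift-homo isP a f m)) n))))
  }
  where isP = polyMul-isSI p

polyMul-δ : ∀ p → polyMul p δ ≗ coeffs p
polyMul-δ [] n = refl
polyMul-δ (x ∷ p) zero = trans (+-identityʳ (x * 1)) (*-identityʳ x)
polyMul-δ (x ∷ p) (suc n) = cong₂ _+_ (*-zeroʳ x) (polyMul-δ p n)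

polyMul-⊕ : ∀ p q f → polyMul (p ⊕ q) f ≗ polyMul p f +ₛ polyMul q f
polyMul-⊕ [] q f n = refl
polyMul-⊕ (x ∷ p) [] f n = sym (+-identityʳ _)
polyMul-⊕ (x ∷ p) (y ∷ q) f n =
  trans (cong₂ _+_ (*-distribʳ-+ (f n) x y)
                   (trans (shift-cong 1 (polyMul-⊕ p q f) n) (shift-+ₛ 1 (polyMul p f) (polyMul q f) n)))
        (interchange (x * f n) _ _ _)

polyMul-monomial : ∀ k f → polyMul (monomial k) f ≗ shift k f
polyMul-monomial zero f n = trans (cong₂ _+_ (+-identityʳ (f n)) (shift-0ₛ 1 n)) (+-identityʳ (f n))
polyMul-monomial (suc k) f n = trans (shift-cong 1 (polyMul-monomial k f) n) (shift-shift 1 k f n)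

polyMul-onePlus : ∀ a f → polyMul ([ 1 ] ⊕ monomial a) f ≗ onePlus a f
polyMul-onePlus a f n =
  trans (polyMul-⊕ [ 1 ] (monomial a) f n) (cong₂ _+_ (polyMul-monomial 0 f n) (polyMul-monomial a f n))

coeffs-one : coeffs [ 1 ] ≗ δ
coeffs-one zero = refl
coeffs-one (suc n) = refl

coeffs-power : ∀ a k → coeffs (([ 1 ] ⊕ monomial a) ^ₚ k) ≗ fold δ (onePlus a) k
coeffs-power a zero = coeffs-one
coeffs-power a (suc k) n =
  trans (coeffs-⊛ ([ 1 ] ⊕ monomial a) _ n)
  (trans (polyMul-onePlus a _ n) (≗-cong (onePlus-isSI a) (coeffs-power a k) n))

coeffs-prodUpTo : ∀ N → coeffs (prodUpTo N) ≗ binaryProduct (downFrom N) δ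
coeffs-prodUpTo zero = coeffs-one
coeffs-prodUpTo (suc N) n = begin
  coeffs (prodUpTo N ⊛ (E ^ₚ (N + 3))) n
    ≡⟨ coeffs-⊛ (prodUpTo N) _ n ⟩
  polyMul (prodUpTo N) (coeffs (E ^ₚ (N + 3))) n
    ≡⟨ ≗-cong (polyMul-isSI (prodUpTo N)) (coeffs-power (2 ^ N) (N + 3)) n ⟩
  polyMul (prodUpTo N) (fold δ E⁺ (N + 3)) n
    ≡⟨ fold-comm (onePlus-isSI (2 ^ N)) (onePlus-comm (polyMul-isSI (prodUpTo N)) (2 ^ N)) (N + 3) δ n ⟩
  fold (polyMul (prodUpTo N) δ) E⁺ (N + 3) n
    ≡⟨ ≗-cong (binaryFactor-isSI N) (λ m → trans (polyMul-δ (prodUpTo N) m) (coeffs-prodUpTo N m)) n ⟩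
  binaryProduct (downFrom (suc N)) δ n ∎
  where
  open ≡-Reasoning
  E = [ 1 ] ⊕ monomial (2 ^ N)
  E⁺ = onePlus (2 ^ N)

coeffs-genTrunc : ∀ N → coeffs (genTrunc N) ≗ shift 2 (binaryProduct (downFrom N) δ)
coeffs-genTrunc N n = trans (coeffs-⊛ (monomial 2) (prodUpTo N) n)
  (trans (polyMul-monomial 2 _ n) (shift-cong 2 (coeffs-prodUpTo N) n))

-- Sets of coloured parts

fibreSize : {A : Set} → (A → ℕ) → List A → Series
fibreSize h S n = length (filter (λ s → h s ≟ n) S)

fibreSize-++ : ∀ {A : Set} (h : A → ℕ) S T → fibreSize h (S ++ T) ≗ fibreSize h S +ₛ fibreSize h T
fibreSize-++ h S T n =
  trans (cong length (filter-++ (λ s → h s ≟ n) S T)) (length-++ (filter (λ s → h s ≟ n) S))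

fibreSize-map : ∀ {A B : Set} (h : B → ℕ) (f : A → B) S →
  fibreSize h (map f S) ≗ fibreSize (h ∘ f) S
fibreSize-map h f [] n = refl
fibreSize-map h f (s ∷ S) n with does (h (f s) ≟ n)
... | true = cong suc (fibreSize-map h f S n)
... | false = fibreSize-map h f S n

fibreSize-offset : ∀ {A : Set} (h : A → ℕ) c S →
  fibreSize (λ s → c + h s) S ≗ shift c (fibreSize h S)
fibreSize-offset h zero S n = refl
fibreSize-offset h (suc c) [] zero = refl
fibreSize-offset h (suc c) (s ∷ S) zero = fibreSize-offset h (suc c) S zero
fibreSize-offset h (suc c) S (suc n) =
  trans (cong length (filter-≐ (λ s → suc c + h s ≟ suc n) (λ s → c + h s ≟ n)
                                (suc-injective , cong suc) S))
        (fibreSize-offset h c S n)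

subsetCount : List ColouredPart → Series
subsetCount L = fibreSize (λ s → sum (map size s)) (subsets L)

subsetCount-[] : subsetCount [] ≗ δ
subsetCount-[] zero = refl
subsetCount-[] (suc n) = refl

subsetCount-∷ : ∀ x L → subsetCount (x ∷ L) ≗ onePlus (size x) (subsetCount L)
subsetCount-∷ x L n = begin
  fibreSize σ (map (x ∷_) (subsets L) ++ subsets L) n
    ≡⟨ fibreSize-++ σ (map (x ∷_) (subsets L)) _ n ⟩
  fibreSize σ (map (x ∷_) (subsets L)) n + subsetCount L n
    ≡⟨ cong (_+ subsetCount L n) (fibreSize-map σ (x ∷_) (subsets L) n) ⟩
  fibreSize (λ s → size x + σ s) (subsets L) n + subsetCount L n
    ≡⟨ cong (_+ subsetCount L n) (fibreSize-offset σ (size x) (subsets L) n) ⟩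
  shift (size x) (subsetCount L) n + subsetCount L n
    ≡⟨ +-comm _ (subsetCount L n) ⟩
  onePlus (size x) (subsetCount L) n ∎
  where
  open ≡-Reasoning
  σ : List ColouredPart → ℕ
  σ s = sum (map size s)

subsetCount-colours : ∀ t (cs : List ℕ) M →
  subsetCount (map (t ,_) cs ++ M) ≗ fold (subsetCount M) (onePlus (2 ^ t)) (length cs)
subsetCount-colours t [] M n = refl
subsetCount-colours t (c ∷ cs) M n =
  trans (subsetCount-∷ (t , c) (map (t ,_) cs ++ M) n)
        (≗-cong (onePlus-isSI (2 ^ t)) (subsetCount-colours t cs M) n)

subsetCount-concatMap : ∀ ts →
  subsetCount (concatMap (λ t → map (t ,_) (upTo (t + 3))) ts) ≗ binaryProduct ts δ
subsetCount-concatMap [] = subsetCount-[]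
subsetCount-concatMap (t ∷ ts) n =
  trans (subsetCount-colours t (upTo (t + 3)) _ n)
  (trans (cong (λ k → fold _ (onePlus (2 ^ t)) k n) (length-upTo (t + 3)))
         (≗-cong (binaryFactor-isSI t) (subsetCount-concatMap ts) n))

Q≡binaryProduct : ∀ m → Q m ≡ binaryProduct (downFrom (suc m)) δ m
Q≡binaryProduct m = begin
  Q m
    ≡⟨⟩
  subsetCount (colouredParts m) m
    ≡⟨ subsetCount-concatMap (filter P? us) m ⟩
  binaryProduct (filter P? us) δ m
    ≡⟨ binaryProduct-small (filter (¬? ∘ P?) us) _ large ⟨
  binaryProduct (filter (¬? ∘ P?) us) (binaryProduct (filter P? us) δ) m
    ≡⟨ binaryProduct-partition P? us δ m ⟨
  binaryProduct us δ m
    ≡⟨ binaryProduct-upTo (suc m) δ m ⟩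
  binaryProduct (downFrom (suc m)) δ m ∎
  where
  open ≡-Reasoning
  us = upTo (suc m)
  P? = λ t → 2 ^ t ≤? m
  large : All (λ t → m < 2 ^ t) (filter (¬? ∘ P?) us)
  large = All.map ≰⇒> (all-filter (¬? ∘ P?) us)

-- Binary partitions

partitionSum : (List ℕ → ℕ) → List ℕ → Series
partitionSum g ps m = sum (map g (bparts m m ps))

bparts-fuel : ∀ {f f' m} ps → m ≤ f → m ≤ f' → bparts f m ps ≡ bparts f' m ps
bparts-fuel {m = zero} ps _ _ = refl
bparts-fuel {suc f} {suc f'} {suc n} ps (s≤s n≤f) (s≤s n≤f') = go ps
  where
  go : ∀ ps → bparts (suc f) (suc n) ps ≡ bparts (suc f') (suc n) ps
  go [] = refl
  go (zero ∷ ps) = go ps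
  go (suc p ∷ ps) with p <ᵇ suc n
  ... | true = cong₂ _++_
    (cong (map (suc p ∷_))
          (bparts-fuel (suc p ∷ ps) (≤-trans (m∸n≤m n p) n≤f) (≤-trans (m∸n≤m n p) n≤f')))
    (go ps)
  ... | false = go ps

partitionSum-cons : ∀ g {p} ps → 1 ≤ p →
  partitionSum g (p ∷ ps) ≗ partitionSum g ps +ₛ shift p (partitionSum (g ∘ (p ∷_)) (p ∷ ps))
partitionSum-cons g ps (s≤s z≤n) zero = sym (+-identityʳ _)
partitionSum-cons g {suc p} ps (s≤s z≤n) (suc n) with p <ᵇ suc n | <ᵇ-reflects-< p (suc n)
... | true | ofʸ p<sn = begin
  sum (map g (map (suc p ∷_) L ++ R))
    ≡⟨ cong sum (map-++ g (map (suc p ∷_) L) R) ⟩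
  sum (map g (map (suc p ∷_) L) ++ map g R)
    ≡⟨ sum-++ (map g (map (suc p ∷_) L)) (map g R) ⟩
  sum (map g (map (suc p ∷_) L)) + rest
    ≡⟨ cong (λ xs → sum xs + rest) (map-∘ L) ⟨
  sum (map (g ∘ (suc p ∷_)) L) + rest
    ≡⟨ cong (λ ls → sum (map (g ∘ (suc p ∷_)) ls) + rest) (bparts-fuel (suc p ∷ ps) (m∸n≤m n p) ≤-refl) ⟩
  H (n ∸ p) + rest
    ≡⟨ cong (_+ rest) (shift-≥ (suc p) H p<sn) ⟨
  shift (suc p) H (suc n) + rest
    ≡⟨ +-comm _ rest ⟩
  rest + shift (suc p) H (suc n) ∎
  where
  open ≡-Reasoning
  L = bparts n (n ∸ p) (suc p ∷ ps)
  R = bparts (suc n) (suc n) ps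
  rest = partitionSum g ps (suc n)
  H = partitionSum (g ∘ (suc p ∷_)) (suc p ∷ ps)
... | false | ofⁿ p≮sn =
  sym (trans (cong (partitionSum g ps (suc n) +_) (shift-< (suc p) _ (s≤s (≮⇒≥ p≮sn)))) (+-identityʳ _))

partitionSum-[] : ∀ g → g [] ≡ 1 → partitionSum g [] ≗ δ
partitionSum-[] g g[]≡1 zero = trans (+-identityʳ (g [])) g[]≡1
partitionSum-[] g g[]≡1 (suc n) = refl

bparts-ones : ∀ {f} m → m ≤ f → bparts f m [ 1 ] ≡ [ replicate m 1 ]
bparts-ones zero _ = refl
bparts-ones {suc f} (suc n) (s≤s n≤f) rewrite bparts-ones n n≤f = refl

powersOfTwo : ℕ → List ℕ
powersOfTwo = applyDownFrom (2 ^_)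

∈-powersOfTwo⁻ : ∀ {x k} → x ∈ powersOfTwo k → 1 ≤ x × x < 2 ^ k
∈-powersOfTwo⁻ x∈ with ∈-applyDownFrom⁻ (2 ^_) x∈
... | i , i<k , refl = m^n>0 2 i , ^-monoʳ-< 2 (s≤s (s≤s z≤n)) i<k

powersOfTwo-descending : ∀ k → AllPairs _>_ (powersOfTwo k)
powersOfTwo-descending k =
  AllPairs.applyDownFrom⁺₁ (2 ^_) k (λ j<i _ → ^-monoʳ-< 2 (s≤s (s≤s z≤n)) j<i)

2^-injective : ∀ {i j} → 2 ^ i ≡ 2 ^ j → i ≡ j
2^-injective {i} {j} e =
  trans (sym (⌊log₂[2^n]⌋≡n i)) (trans (cong ⌊log₂_⌋ e) (⌊log₂[2^n]⌋≡n j))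

n<2^n : ∀ n → n < 2 ^ n
n<2^n zero = s≤s z≤n
n<2^n (suc n) =
  ≤-trans (+-mono-≤ (m^n>0 2 n) (n<2^n n)) (≤-reflexive (cong (2 ^ n +_) (sym (+-identityʳ (2 ^ n)))))

reverse-filter : ∀ {A : Set} {P : A → Set} (P? : Decidable P) xs →
  reverse (filter P? xs) ≡ filter P? (reverse xs)
reverse-filter P? [] = refl
reverse-filter P? (x ∷ xs) with P? x
... | yes Px = begin
  reverse (x ∷ filter P? xs)                ≡⟨ unfold-reverse x (filter P? xs) ⟩
  reverse (filter P? xs) ++ [ x ]           ≡⟨ cong₂ _++_ (reverse-filter P? xs) (sym (filter-accept P? Px)) ⟩
  filter P? (reverse xs) ++ filter P? [ x ] ≡⟨ filter-++ P? (reverse xs) [ x ] ⟨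
  filter P? (reverse xs ++ [ x ])           ≡⟨ cong (filter P?) (unfold-reverse x xs) ⟨
  filter P? (reverse (x ∷ xs))              ∎
  where open ≡-Reasoning
... | no ¬Px = begin
  reverse (filter P? xs)                    ≡⟨ reverse-filter P? xs ⟩
  filter P? (reverse xs)                    ≡⟨ ++-identityʳ _ ⟨
  filter P? (reverse xs) ++ []              ≡⟨ cong (filter P? (reverse xs) ++_) (filter-reject P? ¬Px) ⟨
  filter P? (reverse xs) ++ filter P? [ x ] ≡⟨ filter-++ P? (reverse xs) [ x ] ⟨
  filter P? (reverse xs ++ [ x ])           ≡⟨ cong (filter P?) (unfold-reverse x xs) ⟨
  filter P? (reverse (x ∷ xs))              ∎
  where open ≡-Reasoning

bparts-filter : ∀ {B f m} ps → m ≤ B → bparts f m (filter (_≤? B) ps) ≡ bparts f m ps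
bparts-filter {m = zero} ps _ = refl
bparts-filter {f = zero} {suc n} ps _ = refl
bparts-filter {B} {suc f} {suc n} ps m≤B = go ps
  where
  go : ∀ ps → bparts (suc f) (suc n) (filter (_≤? B) ps) ≡ bparts (suc f) (suc n) ps
  keep : ∀ p ps → p ≤ B →
    bparts (suc f) (suc n) (p ∷ filter (_≤? B) ps) ≡ bparts (suc f) (suc n) (p ∷ ps)
  skip : ∀ p ps → ¬ p ≤ B →
    bparts (suc f) (suc n) (filter (_≤? B) ps) ≡ bparts (suc f) (suc n) (p ∷ ps)

  go [] = refl
  go (p ∷ ps) with p ≤? B
  ... | yes p≤B = trans (cong (bparts (suc f) (suc n)) (filter-accept (_≤? B) p≤B)) (keep p ps p≤B)
  ... | no p≰B = trans (cong (bparts (suc f) (suc n)) (filter-reject (_≤? B) p≰B)) (skip p ps p≰B)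

  keep zero ps _ = go ps
  keep (suc p) ps p≤B with p <ᵇ suc n
  ... | true = cong₂ _++_ (cong (map (suc p ∷_)) (trans
          (cong (bparts f (n ∸ p)) (sym (filter-accept (_≤? B) p≤B)))
          (bparts-filter {B} {f} (suc p ∷ ps) (≤-trans (m∸n≤m n p) (≤-trans (n≤1+n n) m≤B)))))
        (go ps)
  ... | false = go ps

  skip zero ps p≰B = ⊥-elim (p≰B z≤n)
  skip (suc p) ps p≰B with p <ᵇ suc n | <ᵇ-reflects-< p (suc n)
  ... | true | ofʸ p<sn = ⊥-elim (p≰B (≤-trans p<sn m≤B))
  ... | false | _ = go ps

𝓑≡bparts : ∀ m → 𝓑 m ≡ bparts m m (powersOfTwo (suc m))
𝓑≡bparts m = begin
  bparts m m (reverse (filter (_≤? m) (map (2 ^_) (upTo (suc m)))))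
    ≡⟨ cong (bparts m m) (reverse-filter (_≤? m) (map (2 ^_) (upTo (suc m)))) ⟩
  bparts m m (filter (_≤? m) (reverse (map (2 ^_) (upTo (suc m)))))
    ≡⟨ cong (bparts m m ∘ filter (_≤? m) ∘ reverse) (map-upTo (2 ^_) (suc m)) ⟩
  bparts m m (filter (_≤? m) (reverse (applyUpTo (2 ^_) (suc m))))
    ≡⟨ cong (bparts m m ∘ filter (_≤? m)) (reverse-applyUpTo (2 ^_) (suc m)) ⟩
  bparts m m (filter (_≤? m) (powersOfTwo (suc m)))
    ≡⟨ bparts-filter {m} {m} (powersOfTwo (suc m)) ≤-refl ⟩
  bparts m m (powersOfTwo (suc m)) ∎
  where open ≡-Reasoning

bparts-parts : ∀ {f m} ps {l} → l ∈ bparts f m ps → All (_∈ ps) l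
bparts-parts {m = zero} ps (here refl) = []
bparts-parts {suc f} {suc n} ps = go ps
  where
  go : ∀ ps {l} → l ∈ bparts (suc f) (suc n) ps → All (_∈ ps) l
  go (zero ∷ ps) l∈ = All.map there (go ps l∈)
  go (suc p ∷ ps) l∈ with p <ᵇ suc n
  ... | false = All.map there (go ps l∈)
  ... | true with ∈-++⁻ (map (suc p ∷_) (bparts f (n ∸ p) (suc p ∷ ps))) l∈
  ...   | inj₂ l∈R = All.map there (go ps l∈R)
  ...   | inj₁ l∈L with ∈-map⁻ (suc p ∷_) l∈L
  ...     | _ , l∈ , refl = here refl ∷ bparts-parts {f} {n ∸ p} (suc p ∷ ps) l∈

bparts-descending : ∀ {f m} ps → AllPairs _>_ ps → ∀ {l} → l ∈ bparts f m ps → AllPairs _≥_ l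
bparts-descending {m = zero} ps _ (here refl) = []
bparts-descending {suc f} {suc n} ps = go ps
  where
  go : ∀ ps → AllPairs _>_ ps → ∀ {l} → l ∈ bparts (suc f) (suc n) ps → AllPairs _≥_ l
  go (zero ∷ ps) (_ ∷ ps↓) l∈ = go ps ps↓ l∈
  go (suc p ∷ ps) (p>ps ∷ ps↓) l∈ with p <ᵇ suc n
  ... | false = go ps ps↓ l∈
  ... | true with ∈-++⁻ (map (suc p ∷_) (bparts f (n ∸ p) (suc p ∷ ps))) l∈
  ...   | inj₂ l∈R = go ps ps↓ l∈R
  ...   | inj₁ l∈L with ∈-map⁻ (suc p ∷_) l∈L
  ...     | _ , l∈ , refl =
    All.map ≤head (bparts-parts {f} {n ∸ p} (suc p ∷ ps) l∈)
    ∷ bparts-descending {f} {n ∸ p} (suc p ∷ ps) (p>ps ∷ ps↓) l∈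
    where
    ≤head : ∀ {x} → x ∈ suc p ∷ ps → x ≤ suc p
    ≤head (here refl) = ≤-refl
    ≤head (there x∈) = <⇒≤ (All.lookup p>ps x∈)

bparts-unique : ∀ {f m} ps → AllPairs _>_ ps → Unique (bparts f m ps)
bparts-unique {m = zero} ps _ = [] ∷ []
bparts-unique {zero} {suc n} ps _ = []
bparts-unique {suc f} {suc n} ps = go ps
  where
  go : ∀ ps → AllPairs _>_ ps → Unique (bparts (suc f) (suc n) ps)
  go [] _ = []
  go (zero ∷ ps) (_ ∷ ps↓) = go ps ps↓
  go (suc p ∷ ps) (p>ps ∷ ps↓) with p <ᵇ suc n
  ... | false = go ps ps↓
  ... | true = Unique.++⁺
    (Unique.map⁺ ∷-injectiveʳ (bparts-unique {f} {n ∸ p} (suc p ∷ ps) (p>ps ∷ ps↓)))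
    (go ps ps↓) disjoint
    where
    disjoint : Disjoint (map (suc p ∷_) (bparts f (n ∸ p) (suc p ∷ ps))) (bparts (suc f) (suc n) ps)
    disjoint (l∈L , l∈R) with ∈-map⁻ (suc p ∷_) l∈L
    ... | _ , _ , refl with bparts-parts {suc f} {suc n} ps l∈R
    ...   | p∈ps ∷ _ = <-irrefl refl (All.lookup p>ps p∈ps)

mult-++ : ∀ v xs ys → mult v (xs ++ ys) ≡ mult v xs + mult v ys
mult-++ v [] ys = refl
mult-++ v (x ∷ xs) ys with x ≟ v
... | yes _ = cong suc (mult-++ v xs ys)
... | no _ = mult-++ v xs ys

mult-none : ∀ {v xs} → All (_≢ v) xs → mult v xs ≡ 0
mult-none [] = refl
mult-none {v} {x ∷ xs} (x≢v ∷ xs≢v) with x ≟ v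
... | yes x≡v = ⊥-elim (x≢v x≡v)
... | no _ = mult-none xs≢v

mult-∷-≡ : ∀ v l → mult v (v ∷ l) ≡ suc (mult v l)
mult-∷-≡ v l with v ≟ v
... | yes _ = refl
... | no v≢v = ⊥-elim (v≢v refl)

mult-∷-≢ : ∀ {x v} l → x ≢ v → mult v (x ∷ l) ≡ mult v l
mult-∷-≢ {x} {v} l x≢v with x ≟ v
... | yes x≡v = ⊥-elim (x≢v x≡v)
... | no _ = refl

mult-replicate : ∀ v j → mult v (replicate j v) ≡ j
mult-replicate v zero = refl
mult-replicate v (suc j) with v ≟ v
... | yes _ = cong suc (mult-replicate v j)
... | no v≢v = ⊥-elim (v≢v refl)

mult-replicate-≢ : ∀ {u v} j → u ≢ v → mult v (replicate j u) ≡ 0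
mult-replicate-≢ j u≢v = mult-none (replicate⁺ j u≢v)

mult-insertDesc : ∀ v x l → mult v (insertDesc x l) ≡ mult v (x ∷ l)
mult-insertDesc v x [] = refl
mult-insertDesc v x (y ∷ ys) with y ≤? x
... | yes _ = refl
... | no _ = begin
  mult v (y ∷ insertDesc x ys)
    ≡⟨ mult-++ v [ y ] (insertDesc x ys) ⟩
  mult v [ y ] + mult v (insertDesc x ys)
    ≡⟨ cong (mult v [ y ] +_) (trans (mult-insertDesc v x ys) (mult-++ v [ x ] ys)) ⟩
  mult v [ y ] + (mult v [ x ] + mult v ys)
    ≡⟨ x∙yz≈y∙xz (mult v [ y ]) (mult v [ x ]) (mult v ys) ⟩
  mult v [ x ] + (mult v [ y ] + mult v ys)
    ≡⟨ cong (mult v [ x ] +_) (mult-++ v [ y ] ys) ⟨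
  mult v [ x ] + mult v (y ∷ ys)
    ≡⟨ mult-++ v [ x ] (y ∷ ys) ⟨
  mult v (x ∷ y ∷ ys) ∎
  where open ≡-Reasoning

mult-sortDesc : ∀ v l → mult v (sortDesc l) ≡ mult v l
mult-sortDesc v [] = refl
mult-sortDesc v (x ∷ xs) = begin
  mult v (insertDesc x (sortDesc xs)) ≡⟨ mult-insertDesc v x (sortDesc xs) ⟩
  mult v (x ∷ sortDesc xs)            ≡⟨ mult-++ v [ x ] (sortDesc xs) ⟩
  mult v [ x ] + mult v (sortDesc xs) ≡⟨ cong (mult v [ x ] +_) (mult-sortDesc v xs) ⟩
  mult v [ x ] + mult v xs            ≡⟨ mult-++ v [ x ] xs ⟨
  mult v (x ∷ xs)                     ∎
  where open ≡-Reasoning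

mult-map-filter : ∀ {P : ℕ → Set} (P? : Decidable P) {f : ℕ → ℕ} {v} →
  (∀ y → ¬ P y → f y ≢ v) →
  ∀ xs → mult v (map f xs) ≡ mult v (map f (filter P? xs))
mult-map-filter P? out [] = refl
mult-map-filter P? {f} {v} out (y ∷ ys) with P? y
... | yes _ = trans (mult-++ v [ f y ] (map f ys))
  (trans (cong (mult v [ f y ] +_) (mult-map-filter P? out ys)) (sym (mult-++ v [ f y ] _)))
... | no ¬Py = trans (mult-∷-≢ (map f ys) (out y ¬Py)) (mult-map-filter P? out ys)

mult-map-injective : ∀ {f : ℕ → ℕ} → (∀ {x y} → f x ≡ f y → x ≡ y) →
  ∀ u xs → mult (f u) (map f xs) ≡ mult u xs
mult-map-injective f-inj u [] = refl
mult-map-injective {f} f-inj u (y ∷ ys) with f y ≟ f u | y ≟ u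
... | yes _ | yes _ = cong suc (mult-map-injective f-inj u ys)
... | no _ | no _ = mult-map-injective f-inj u ys
... | yes fy≡fu | no y≢u = ⊥-elim (y≢u (f-inj fy≡fu))
... | no fy≢fu | yes refl = ⊥-elim (fy≢fu refl)

map-1* : ∀ xs → map (1 *_) xs ≡ xs
map-1* xs = trans (map-cong *-identityˡ xs) (map-id xs)

mult-filter-accept : ∀ {P : ℕ → Set} (P? : Decidable P) {u} → P u →
  ∀ xs → mult u (filter P? xs) ≡ mult u xs
mult-filter-accept P? Pu [] = refl
mult-filter-accept {P} P? {u} Pu (y ∷ ys) with P? y
... | yes _ = trans (mult-++ u [ y ] (filter P? ys))
  (trans (cong (mult u [ y ] +_) (mult-filter-accept P? Pu ys)) (sym (mult-++ u [ y ] ys)))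
... | no ¬Py =
  trans (mult-filter-accept P? Pu ys) (sym (mult-∷-≢ {y} ys (λ y≡u → ¬Py (subst P (sym y≡u) Pu))))

mult-filter-reject : ∀ {P : ℕ → Set} (P? : Decidable P) {u} → ¬ P u →
  ∀ xs → mult u (filter P? xs) ≡ 0
mult-filter-reject {P} P? ¬Pu xs =
  mult-none (All.map (λ Py y≡u → ¬Pu (subst P y≡u Py)) (all-filter P? xs))

mult-pos⇒∈ : ∀ {v} l → mult v l ≢ 0 → v ∈ l
mult-pos⇒∈ [] m≢0 = ⊥-elim (m≢0 refl)
mult-pos⇒∈ {v} (x ∷ xs) m≢0 with x ≟ v
... | yes x≡v = here (sym x≡v)
... | no _ = there (mult-pos⇒∈ xs m≢0)

mult≤length : ∀ v l → mult v l ≤ length l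
mult≤length v [] = z≤n
mult≤length v (x ∷ xs) with x ≟ v
... | yes _ = s≤s (mult≤length v xs)
... | no _ = m≤n⇒m≤1+n (mult≤length v xs)

descending-ext : ∀ {xs ys} → AllPairs _≥_ xs → AllPairs _≥_ ys →
  (∀ v → mult v xs ≡ mult v ys) → xs ≡ ys
descending-ext [] [] _ = refl
descending-ext {[]} {y ∷ ys} [] _ same = ⊥-elim (0≢1+n (trans (same y) (mult-∷-≡ y ys)))
descending-ext {x ∷ xs} {[]} _ [] same = ⊥-elim (0≢1+n (trans (sym (same x)) (mult-∷-≡ x xs)))
descending-ext {x ∷ xs} {y ∷ ys} (x≥xs ∷ xs↓) (y≥ys ∷ ys↓) same =
  cong₂ _∷_ x≡y (descending-ext xs↓ ys↓ same-tail)
  where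
  ≤head : ∀ {z a as} → All (a ≥_) as → z ∈ a ∷ as → z ≤ a
  ≤head _ (here refl) = ≤-refl
  ≤head a≥as (there z∈as) = All.lookup a≥as z∈as
  x≡y : x ≡ y
  x≡y = ≤-antisym
    (≤head y≥ys (mult-pos⇒∈ (y ∷ ys) λ e → 1+n≢0 (trans (sym (mult-∷-≡ x xs)) (trans (same x) e))))
    (≤head x≥xs (mult-pos⇒∈ (x ∷ xs) λ e → 1+n≢0 (trans (sym (mult-∷-≡ y ys)) (trans (sym (same y)) e))))
  same-tail : ∀ v → mult v xs ≡ mult v ys
  same-tail v = +-cancelˡ-≡ (mult v [ x ]) _ _ (begin
    mult v [ x ] + mult v xs ≡⟨ mult-++ v [ x ] xs ⟨
    mult v (x ∷ xs)          ≡⟨ same v ⟩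
    mult v (y ∷ ys)          ≡⟨ mult-++ v [ y ] ys ⟩
    mult v [ y ] + mult v ys ≡⟨ cong (λ z → mult v [ z ] + mult v ys) x≡y ⟨
    mult v [ x ] + mult v ys ∎)
    where open ≡-Reasoning

-- Binomial weights

binomialWeight : ℕ → List ℕ → ℕ
binomialWeight n l = product (map (λ i → (i + 3) C mult (2 ^ i) l) (upTo (suc n)))

product-split : ∀ {F F₀ : ℕ → ℕ} {t R} → Unique R → t ∈ R → F₀ t ≡ 1 →
  (∀ i → i ≢ t → F i ≡ F₀ i) →
  product (map F R) ≡ F t * product (map F₀ R)
product-split {F} {F₀} {t} {_ ∷ R} (t∉R ∷ _) (here refl) F₀t≡1 F≡F₀ =
  cong (F t *_) (trans (cong product (map-cong-local (All.map (λ t≢i → F≡F₀ _ (t≢i ∘ sym)) t∉R)))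
                       (sym (trans (cong (_* product (map F₀ R)) F₀t≡1) (*-identityˡ _))))
product-split {F} {F₀} {t} (x∉R ∷ R!) (there t∈R) F₀t≡1 F≡F₀ =
  trans (cong₂ _*_ (F≡F₀ _ (λ x≡t → All.lookup x∉R t∈R x≡t)) (product-split R! t∈R F₀t≡1 F≡F₀))
        (*.x∙yz≈y∙xz (F₀ _) (F t) _)

binomialWeight-split : ∀ {n t} j μ → t ≤ n → All (_≢ 2 ^ t) μ →
  binomialWeight n (replicate j (2 ^ t) ++ μ) ≡ ((t + 3) C j) * binomialWeight n μ
binomialWeight-split {n} {t} j μ t≤n μ≢2^t =
  trans (product-split (Unique.upTo⁺ (suc n)) (∈-upTo⁺ (s≤s t≤n))
                       (cong ((t + 3) C_) (mult-none μ≢2^t)) F≡F₀)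
        (cong (λ k → ((t + 3) C k) * _) (trans (mult-++ (2 ^ t) (replicate j (2 ^ t)) μ)
          (trans (cong₂ _+_ (mult-replicate (2 ^ t) j) (mult-none μ≢2^t)) (+-identityʳ j))))
  where
  F≡F₀ : ∀ i → i ≢ t →
    ((i + 3) C mult (2 ^ i) (replicate j (2 ^ t) ++ μ)) ≡ ((i + 3) C mult (2 ^ i) μ)
  F≡F₀ i i≢t = cong ((i + 3) C_) (trans (mult-++ (2 ^ i) (replicate j (2 ^ t)) μ)
    (cong (_+ mult (2 ^ i) μ) (mult-replicate-≢ j (i≢t ∘ sym ∘ 2^-injective))))

product-ones : ∀ (R : List ℕ) → product (map (λ _ → 1) R) ≡ 1
product-ones [] = refl
product-ones (_ ∷ R) = trans (+-identityʳ _) (product-ones R)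

sum-map-scale : ∀ {A : Set} {g h : A → ℕ} c xs →
  (∀ {x} → x ∈ xs → g x ≡ c * h x) → sum (map g xs) ≡ c * sum (map h xs)
sum-map-scale c [] _ = sym (*-zeroʳ c)
sum-map-scale {h = h} c (x ∷ xs) g≡ch =
  trans (cong₂ _+_ (g≡ch (here refl)) (sum-map-scale c xs (g≡ch ∘ there))) (sym (*-distribˡ-+ c (h x) _))

replicate-++-∷ : ∀ {A : Set} j (x : A) l → replicate j x ++ x ∷ l ≡ x ∷ replicate j x ++ l
replicate-++-∷ zero x l = refl
replicate-++-∷ (suc j) x l = cong (x ∷_) (replicate-++-∷ j x l)

partitionSum-binomialWeight : ∀ n t → t ≤ suc n →
  partitionSum (binomialWeight n) (powersOfTwo t) ≗ binaryProduct (downFrom t) δ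
partitionSum-binomialWeight n zero _ = partitionSum-[] (binomialWeight n) (product-ones (upTo (suc n)))
partitionSum-binomialWeight n (suc t) (s≤s t≤n) m =
  trans (binomial-unique p>0 V-rec m)
        (≗-cong (binaryFactor-isSI t) (partitionSum-binomialWeight n t (m≤n⇒m≤1+n t≤n)) m)
  where
  p = 2 ^ t
  p>0 = m^n>0 2 t
  W = binomialWeight n
  -- V j weighs each partition as if it had j more parts p.
  V : ℕ → Series
  V j = partitionSum (λ l → W (replicate j p ++ l)) (p ∷ powersOfTwo t)
  V-rec : ∀ j → V j ≗ ((t + 3) C j) ·ₛ partitionSum W (powersOfTwo t) +ₛ shift p (V (suc j))
  V-rec j m = trans (partitionSum-cons (λ l → W (replicate j p ++ l)) (powersOfTwo t) p>0 m) (cong₂ _+_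
    (sum-map-scale {h = W} ((t + 3) C j) (bparts m m (powersOfTwo t)) (λ l∈ → binomialWeight-split j _ t≤n
      (All.map (λ x∈ → <⇒≢ (proj₂ (∈-powersOfTwo⁻ x∈))) (bparts-parts {m} {m} (powersOfTwo t) l∈))))
    (shift-cong p (λ m → cong sum (map-cong (λ l → cong W (replicate-++-∷ j p l)) (bparts m m _))) m))

binomSum≡binaryProduct : ∀ n → binomSum n ≡ binaryProduct (downFrom (suc n)) δ n
binomSum≡binaryProduct n =
  trans (cong (sum ∘ map (binomialWeight n)) (𝓑≡bparts n)) (partitionSum-binomialWeight n (suc n) ≤-refl n)

-- Pairs of ones

suc-C2 : ∀ k → suc k C 2 ≡ k + k C 2
suc-C2 k = trans (sym (nCk+nC[k+1]≡[n+1]C[k+1] k 1)) (cong (_+ k C 2) (nC1≡n k))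

C2-series : (_C 2) ≗ fold (shift 2 δ) (geom 1) 3
C2-series n = trans (geom-unique 1>0 C2-rec n)
  (≗-cong (geom-isSI 1>0) (λ m →
    trans (geom-unique 1>0 pred-rec m) (≗-cong (geom-isSI 1>0) (geom-unique 1>0 ones-rec) m)) n)
  where
  1>0 : 1 ≤ 1
  1>0 = ≤-refl
  ones≥2 : Series
  ones≥2 = shift 2 (λ _ → 1)
  ones-rec : ones≥2 ≗ shift 2 δ +ₛ shift 1 ones≥2
  ones-rec 0 = refl
  ones-rec 1 = refl
  ones-rec 2 = refl
  ones-rec (suc (suc (suc n))) = refl
  pred-rec : (_∸ 1) ≗ ones≥2 +ₛ shift 1 (_∸ 1)
  pred-rec 0 = refl
  pred-rec 1 = refl
  pred-rec (suc (suc n)) = refl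
  C2-rec : (_C 2) ≗ (_∸ 1) +ₛ shift 1 (_C 2)
  C2-rec zero = refl
  C2-rec (suc k) = suc-C2 k

pairsOfOnes : List ℕ → ℕ
pairsOfOnes l = mult 1 l C 2

pairsOfOnesSum : ℕ → Series
pairsOfOnesSum t = partitionSum pairsOfOnes (powersOfTwo (suc t))

pairsOfOnesSum-zero : pairsOfOnesSum 0 ≗ (_C 2)
pairsOfOnesSum-zero m rewrite bparts-ones {m} m ≤-refl =
  trans (+-identityʳ _) (cong (_C 2) (mult-replicate 1 m))

pairsOfOnesSum-suc : ∀ t → pairsOfOnesSum (suc t) ≗ geom (2 ^ suc t) (pairsOfOnesSum t)
pairsOfOnesSum-suc t = geom-unique p>0 (λ m →
  trans (partitionSum-cons pairsOfOnes (powersOfTwo (suc t)) p>0 m)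
        (cong (pairsOfOnesSum t m +_) (shift-cong p (λ m' →
          cong sum (map-cong (λ l → cong (_C 2) (mult-∷-≢ l p≢1)) (bparts m' m' _))) m)))
  where
  p = 2 ^ suc t
  p>0 = m^n>0 2 (suc t)
  p≢1 : p ≢ 1
  p≢1 e = 1+n≢0 (2^-injective {suc t} {0} e)

-- Like pairsOfOnesSum t, this is q² (1-q)⁻³ ∏_{1≤i≤t} (1-q^(2^i))⁻¹.
pairsOfOnesProduct : ℕ → Series
pairsOfOnesProduct t = binaryProduct (downFrom (suc t)) (fold (shift 2 δ) (geom (2 ^ suc t)) (t + 3))

pairsOfOnesProduct-zero : (_C 2) ≗ pairsOfOnesProduct 0
pairsOfOnesProduct-zero n = trans (C2-series n) (sym (fold-onePlus-geom ≤-refl 3 (shift 2 δ) n))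

pairsOfOnesProduct-suc : ∀ t → pairsOfOnesProduct (suc t) ≗ geom (2 ^ suc t) (pairsOfOnesProduct t)
pairsOfOnesProduct-suc t n = begin
  binaryFactor (suc t) (binaryProduct ts (fold q² (geom (2 * p)) (suc t + 3))) n
    ≡⟨ binaryProduct-comm (binaryFactor-isSI (suc t)) ts _ n ⟩
  binaryProduct ts (fold (fold q² (geom (2 * p)) (suc t + 3)) (onePlus p) (suc t + 3)) n
    ≡⟨ ≗-cong (binaryProduct-isSI ts) (fold-onePlus-geom p>0 (suc t + 3) q²) n ⟩
  binaryProduct ts (geom p (fold q² (geom p) (t + 3))) n
    ≡⟨ geom-comm p>0 (binaryProduct-isSI ts) _ n ⟩
  geom p (pairsOfOnesProduct t) n ∎
  where
  open ≡-Reasoning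
  p = 2 ^ suc t
  p>0 = m^n>0 2 (suc t)
  ts = downFrom (suc t)
  q² = shift 2 δ

pairsOfOnesSum≗pairsOfOnesProduct : ∀ t → pairsOfOnesSum t ≗ pairsOfOnesProduct t
pairsOfOnesSum≗pairsOfOnesProduct zero n = trans (pairsOfOnesSum-zero n) (pairsOfOnesProduct-zero n)
pairsOfOnesSum≗pairsOfOnesProduct (suc t) n = trans (pairsOfOnesSum-suc t n)
  (trans (≗-cong (geom-isSI (m^n>0 2 (suc t))) (pairsOfOnesSum≗pairsOfOnesProduct t) n)
         (sym (pairsOfOnesProduct-suc t n)))

pairsOfOnesSum-diagonal : ∀ m → pairsOfOnesSum m m ≡ shift 2 (binaryProduct (downFrom (suc m)) δ) m
pairsOfOnesSum-diagonal m = begin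
  pairsOfOnesSum m m
    ≡⟨ pairsOfOnesSum≗pairsOfOnesProduct m m ⟩
  binaryProduct ts (fold q² (geom p) (m + 3)) m
    ≡⟨ fold-comm (geom-isSI p>0) (geom-comm p>0 (binaryProduct-isSI ts)) (m + 3) q² m ⟩
  fold (binaryProduct ts q²) (geom p) (m + 3) m
    ≡⟨ fold-geom-small (binaryProduct ts q²) (m + 3) (<-trans (n<1+n m) (n<2^n (suc m))) ⟩
  binaryProduct ts q² m
    ≡⟨ binaryProduct-comm (shift-isSI 2) ts δ m ⟨
  shift 2 (binaryProduct ts δ) m ∎
  where
  open ≡-Reasoning
  p = 2 ^ suc m
  p>0 = m^n>0 2 (suc m)
  ts = downFrom (suc m)
  q² = shift 2 δ

-- The image of pre₂

mult1-pairProducts : ∀ l → mult 1 (pairProducts l) ≡ mult 1 l C 2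
mult1-pairProducts [] = refl
mult1-pairProducts (x ∷ xs) with x ≟ 1
... | yes refl = begin
  mult 1 (map (1 *_) xs ++ pairProducts xs)
    ≡⟨ mult-++ 1 (map (1 *_) xs) (pairProducts xs) ⟩
  mult 1 (map (1 *_) xs) + mult 1 (pairProducts xs)
    ≡⟨ cong₂ _+_ (cong (mult 1) (map-1* xs)) (mult1-pairProducts xs) ⟩
  mult 1 xs + mult 1 xs C 2
    ≡⟨ suc-C2 (mult 1 xs) ⟨
  suc (mult 1 xs) C 2 ∎
  where open ≡-Reasoning
... | no x≢1 = trans (mult-++ 1 (map (x *_) xs) (pairProducts xs))
  (cong₂ _+_ (mult-none (map⁺ (All.universal (λ y → x≢1 ∘ m*n≡1⇒m≡1 x y) xs))) (mult1-pairProducts xs))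

m≢1∧v≤n⇒m*n≢v : ∀ {m n v} → 0 < v → m ≢ 1 → v ≤ n → m * n ≢ v
m≢1∧v≤n⇒m*n≢v {zero} v>0 _ _ = <⇒≢ v>0
m≢1∧v≤n⇒m*n≢v {suc zero} _ m≢1 _ = ⊥-elim (m≢1 refl)
m≢1∧v≤n⇒m*n≢v {m@(suc (suc _))} {n} v>0 _ v≤n m*n≡v =
  <-irrefl (sym m*n≡v) (≤-<-trans v≤n n<m*n)
  where
  n<m*n : n < m * n
  n<m*n = <-≤-trans (m<m*n n m {{>-nonZero (≤-trans v>0 v≤n)}} (s≤s (s≤s z≤n)))
                    (≤-reflexive (*-comm n m))

v<m⇒m*n≢v : ∀ {m n v} → 0 < v → v < m → m * n ≢ v
v<m⇒m*n≢v {m} {zero} v>0 _ m*0≡v = <⇒≢ v>0 (trans (sym (*-zeroʳ m)) m*0≡v)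
v<m⇒m*n≢v {m} {suc n} _ v<m m*n≡v = <-irrefl (sym m*n≡v) (<-≤-trans v<m (m≤m*n m (suc n)))

-- A product of two parts equals v ≥ 2 iff it is 1·v or both factors lie in [2, v).
module _ {v} (v≥2 : 2 ≤ v) (xs : List ℕ) where
  private
    open ≡-Reasoning
    v>0 = ≤-trans (s≤s z≤n) v≥2
    k = mult 1 xs
    c = mult v xs
    F = filter (_<? v) xs
    R = mult v (pairProducts F)

  mult-pairProducts-∷ : ∀ x →
    mult v (map (x *_) xs) + (mult 1 xs * mult v xs + mult v (pairProducts (filter (_<? v) xs))) ≡
    mult 1 (x ∷ xs) * mult v (x ∷ xs) + mult v (pairProducts (filter (_<? v) (x ∷ xs)))
  mult-pairProducts-∷ x with x ≟ 1 | x ≟ v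
  ... | yes refl | yes refl = ⊥-elim (<-irrefl refl v≥2)
  ... | yes refl | no _ = begin
    mult v (map (1 *_) xs) + (k * c + R)
      ≡⟨ cong (λ ys → mult v ys + (k * c + R)) (map-1* xs) ⟩
    c + (k * c + R)
      ≡⟨ +-assoc c (k * c) R ⟨
    suc k * c + R
      ≡⟨ cong (λ m → suc k * c + (m + R)) (mult-filter-reject (_<? v) (<-irrefl refl) xs) ⟨
    suc k * c + (mult v F + R)
      ≡⟨ cong (λ ys → suc k * c + (mult v ys + R)) (map-1* F) ⟨
    suc k * c + (mult v (map (1 *_) F) + R)
      ≡⟨ cong (suc k * c +_) (mult-++ v (map (1 *_) F) (pairProducts F)) ⟨
    suc k * c + mult v (pairProducts (1 ∷ F))
      ≡⟨ cong (λ ys → suc k * c + mult v (pairProducts ys)) (filter-accept (_<? v) v≥2) ⟨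
    suc k * c + mult v (pairProducts (filter (_<? v) (1 ∷ xs))) ∎
  ... | no x≢1 | yes refl = begin
    mult v (map (v *_) xs) + (k * c + R)
      ≡⟨ cong (λ u → mult u (map (v *_) xs) + (k * c + R)) (*-identityʳ v) ⟨
    mult (v * 1) (map (v *_) xs) + (k * c + R)
      ≡⟨ cong (_+ (k * c + R)) (mult-map-injective (*-cancelˡ-≡ _ _ v {{>-nonZero v>0}}) 1 xs) ⟩
    k + (k * c + R)
      ≡⟨ +-assoc k (k * c) R ⟨
    k + k * c + R
      ≡⟨ cong (_+ R) (*-suc k c) ⟨
    k * suc c + R
      ≡⟨ cong (λ ys → k * suc c + mult v (pairProducts ys)) (filter-reject (_<? v) (<-irrefl refl)) ⟨
    k * suc c + mult v (pairProducts (filter (_<? v) (v ∷ xs))) ∎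
  ... | no x≢1 | no x≢v with x <? v
  ...   | yes x<v = begin
    mult v (map (x *_) xs) + (k * c + R)
      ≡⟨ cong (_+ (k * c + R)) (mult-map-filter (_<? v) (λ _ → m≢1∧v≤n⇒m*n≢v v>0 x≢1 ∘ ≮⇒≥) xs) ⟩
    mult v (map (x *_) F) + (k * c + R)
      ≡⟨ x∙yz≈y∙xz (mult v (map (x *_) F)) (k * c) R ⟩
    k * c + (mult v (map (x *_) F) + R)
      ≡⟨ cong (k * c +_) (mult-++ v (map (x *_) F) (pairProducts F)) ⟨
    k * c + mult v (pairProducts (x ∷ F))
      ≡⟨ cong (λ ys → k * c + mult v (pairProducts ys)) (filter-accept (_<? v) x<v) ⟨
    k * c + mult v (pairProducts (filter (_<? v) (x ∷ xs))) ∎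
  ...   | no x≮v = cong₂ _+_
    (mult-none (map⁺ (All.universal (λ _ → v<m⇒m*n≢v v>0 (≤∧≢⇒< (≮⇒≥ x≮v) (x≢v ∘ sym))) xs)))
    (cong (λ ys → mult 1 xs * mult v xs + mult v (pairProducts ys)) (sym (filter-reject (_<? v) x≮v)))

mult-pairProducts : ∀ {v} → 2 ≤ v → ∀ l →
  mult v (pairProducts l) ≡ mult 1 l * mult v l + mult v (pairProducts (filter (_<? v) l))
mult-pairProducts v≥2 [] = refl
mult-pairProducts {v} v≥2 (x ∷ xs) =
  trans (mult-++ v (map (x *_) xs) (pairProducts xs))
        (trans (cong (mult v (map (x *_) xs) +_) (mult-pairProducts v≥2 xs)) (mult-pairProducts-∷ v≥2 xs x))

C2-pos : ∀ {k} → k C 2 ≢ 0 → 1 ≤ k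
C2-pos {zero} k≢0 = ⊥-elim (k≢0 refl)
C2-pos {suc k} _ = s≤s z≤n

C2-strictMono : ∀ {a b} → 1 ≤ a → a < b → a C 2 < b C 2
C2-strictMono {a} {suc b} a>0 (s≤s a≤b) with m≤n⇒m<n∨m≡n a≤b
... | inj₁ a<b =
  <-≤-trans (C2-strictMono a>0 a<b) (≤-trans (m≤n+m (b C 2) b) (≤-reflexive (sym (suc-C2 b))))
... | inj₂ refl = <-≤-trans (m<n+m (a C 2) a>0) (≤-reflexive (sym (suc-C2 a)))

C2-injective : ∀ {a b} → a C 2 ≡ b C 2 → a C 2 ≢ 0 → a ≡ b
C2-injective {a} {b} e nz with <-cmp a b
... | tri< a<b _ _ = ⊥-elim (<-irrefl e (C2-strictMono (C2-pos nz) a<b))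
... | tri≈ _ a≡b _ = a≡b
... | tri> _ _ b<a = ⊥-elim (<-irrefl (sym e) (C2-strictMono (C2-pos (nz ∘ trans e)) b<a))

-- m_v(λ) is read off m_v(pre₂ λ) by strong induction on v, which needs m_1(λ) ≠ 0.
pre₂-injective : ∀ {l l'} → AllPairs _≥_ l → AllPairs _≥_ l' → All (1 ≤_) l → All (1 ≤_) l' →
  pre₂ l ≡ pre₂ l' → mult 1 (pre₂ l) ≢ 0 → l ≡ l'
pre₂-injective {l} {l'} l↓ l'↓ l>0 l'>0 eq nz = descending-ext l↓ l'↓ (<-rec _ same-mult)
  where
  pp-eq : ∀ v → mult v (pairProducts l) ≡ mult v (pairProducts l')
  pp-eq v = trans (sym (mult-sortDesc v (pairProducts l)))
                  (trans (cong (mult v) eq) (mult-sortDesc v (pairProducts l')))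
  k = mult 1 l
  k≢0 : k C 2 ≢ 0
  k≢0 e = nz (trans (mult-sortDesc 1 (pairProducts l)) (trans (mult1-pairProducts l) e))
  ones-eq : k ≡ mult 1 l'
  ones-eq = C2-injective (trans (sym (mult1-pairProducts l)) (trans (pp-eq 1) (mult1-pairProducts l'))) k≢0
  no-zeros : ∀ {xs} → All (1 ≤_) xs → mult 0 xs ≡ 0
  no-zeros xs>0 = mult-none (All.map (λ x>0 x≡0 → <⇒≢ x>0 (sym x≡0)) xs>0)
  same-mult : ∀ v → (∀ {u} → u < v → mult u l ≡ mult u l') → mult v l ≡ mult v l'
  same-mult zero _ = trans (no-zeros l>0) (sym (no-zeros l'>0))
  same-mult (suc zero) _ = ones-eq
  same-mult v@(suc (suc _)) ih = *-cancelˡ-≡ _ _ k {{>-nonZero (C2-pos k≢0)}} (+-cancelʳ-≡ _ _ _ (begin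
    k * mult v l + mult v (pairProducts (F l))
      ≡⟨ mult-pairProducts v≥2 l ⟨
    mult v (pairProducts l)
      ≡⟨ pp-eq v ⟩
    mult v (pairProducts l')
      ≡⟨ mult-pairProducts v≥2 l' ⟩
    mult 1 l' * mult v l' + mult v (pairProducts (F l'))
      ≡⟨ cong₂ (λ a b → a * mult v l' + mult v (pairProducts b)) (sym ones-eq) (sym F-eq) ⟩
    k * mult v l' + mult v (pairProducts (F l)) ∎))
    where
    open ≡-Reasoning
    v≥2 : 2 ≤ v
    v≥2 = s≤s (s≤s z≤n)
    F = filter (_<? v)
    F-eq : F l ≡ F l'
    F-eq = descending-ext (AllPairs.filter⁺ (_<? v) l↓) (AllPairs.filter⁺ (_<? v) l'↓) same-below
      where
      same-below : ∀ u → mult u (F l) ≡ mult u (F l')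
      same-below u with u <? v
      ... | yes u<v =
        trans (mult-filter-accept (_<? v) u<v l) (trans (ih u<v) (sym (mult-filter-accept (_<? v) u<v l')))
      ... | no u≮v = trans (mult-filter-reject (_<? v) u≮v l) (sym (mult-filter-reject (_<? v) u≮v l'))

sum-filter-zero : ∀ {A : Set} {P : A → Set} (P? : Decidable P) (g : A → ℕ) xs →
  (∀ {y} → y ∈ xs → ¬ P y → g y ≡ 0) → sum (map g (filter P? xs)) ≡ sum (map g xs)
sum-filter-zero P? g [] _ = refl
sum-filter-zero P? g (y ∷ ys) dropped≡0 with P? y
... | yes _ = cong (g y +_) (sum-filter-zero P? g ys (dropped≡0 ∘ there))
... | no ¬Py = trans (sum-filter-zero P? g ys (dropped≡0 ∘ there))
                    (sym (cong (_+ sum (map g ys)) (dropped≡0 (here refl) ¬Py)))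

sum-deduplicate : ∀ {A : Set} (_≟ᴬ_ : DecidableEquality A) (g : A → ℕ) xs →
  AllPairs (λ x y → g x ≡ 0 ⊎ x ≢ y) xs → sum (map g (deduplicate _≟ᴬ_ xs)) ≡ sum (map g xs)
sum-deduplicate _≟ᴬ_ g [] _ = refl
sum-deduplicate _≟ᴬ_ g (x ∷ xs) (x-vs-xs ∷ xs!) =
  cong (g x +_) (trans (sum-filter-zero (¬? ∘ (x ≟ᴬ_)) g (deduplicate _≟ᴬ_ xs) dropped≡0)
                       (sum-deduplicate _≟ᴬ_ g xs xs!))
  where
  dropped≡0 : ∀ {y} → y ∈ deduplicate _≟ᴬ_ xs → ¬ ¬ x ≡ y → g y ≡ 0
  dropped≡0 {y} y∈ ¬x≢y with All.lookup x-vs-xs (∈-deduplicate⁻ _≟ᴬ_ xs y∈)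
  ... | inj₁ gx≡0 = subst (λ z → g z ≡ 0) (decidable-stable (x ≟ᴬ y) ¬x≢y) gx≡0
  ... | inj₂ x≢y = ⊥-elim (¬x≢y x≢y)

sum-deduplicate-map : ∀ {A B : Set} {P : A → Set} (_≟ᴮ_ : DecidableEquality B) (f : A → B) (g : B → ℕ)
  xs → All P xs → Unique xs → (∀ {x y} → P x → P y → f x ≡ f y → g (f x) ≢ 0 → x ≡ y) →
  sum (map g (deduplicate _≟ᴮ_ (map f xs))) ≡ sum (map (g ∘ f) xs)
sum-deduplicate-map {P = P} _≟ᴮ_ f g xs Pxs xs! f-inj =
  trans (sum-deduplicate _≟ᴮ_ g (map f xs) (AllPairs.map⁺ (separated Pxs xs!))) (cong sum (sym (map-∘ xs)))
  where
  separated : ∀ {xs} → All P xs → Unique xs → AllPairs (λ x y → g (f x) ≡ 0 ⊎ f x ≢ f y) xs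
  separated [] [] = []
  separated {x ∷ _} (Px ∷ Pxs) (x≢xs ∷ xs!) = All.zipWith apart (Pxs , x≢xs) ∷ separated Pxs xs!
    where
    apart : ∀ {y} → P y × x ≢ y → g (f x) ≡ 0 ⊎ f x ≢ f y
    apart (Py , x≢y) with g (f x) ≟ 0
    ... | yes gfx≡0 = inj₁ gfx≡0
    ... | no gfx≢0 = inj₂ (λ fx≡fy → x≢y (f-inj Px Py fx≡fy gfx≢0))

a≡pairsOfOnesSum : ∀ m → a m ≡ pairsOfOnesSum m m
a≡pairsOfOnesSum m = begin
  a m
    ≡⟨⟩
  sum (map (mult 1) (deduplicate (≡-dec _≟_) (map pre₂ L)))
    ≡⟨ sum-deduplicate-map (≡-dec _≟_) pre₂ (mult 1) L sorted unique
      (λ (l↓ , l>0) (l'↓ , l'>0) → pre₂-injective l↓ l'↓ l>0 l'>0) ⟩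
  sum (map (mult 1 ∘ pre₂) L)
    ≡⟨ cong sum (map-cong (λ l → trans (mult-sortDesc 1 (pairProducts l)) (mult1-pairProducts l)) L) ⟩
  sum (map pairsOfOnes L)
    ≡⟨ sum-filter-zero P? pairsOfOnes (𝓑 m) (λ {l} _ → few-ones l) ⟩
  sum (map pairsOfOnes (𝓑 m))
    ≡⟨ cong (sum ∘ map pairsOfOnes) (𝓑≡bparts m) ⟩
  pairsOfOnesSum m m ∎
  where
  open ≡-Reasoning
  P? = λ (l : List ℕ) → 2 ≤? length l
  L = filter P? (𝓑 m)
  few-ones : ∀ l → ¬ 2 ≤ length l → pairsOfOnes l ≡ 0
  few-ones l short = k>n⇒nCk≡0 (≤-<-trans (mult≤length 1 l) (≰⇒> short))
  ps = powersOfTwo (suc m)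
  ∈bparts : ∀ {l} → l ∈ L → l ∈ bparts m m ps
  ∈bparts l∈L = subst (_ ∈_) (𝓑≡bparts m) (proj₁ (∈-filter⁻ P? l∈L))
  sorted : All (λ l → AllPairs _≥_ l × All (1 ≤_) l) L
  sorted = All.tabulate λ l∈L →
    bparts-descending {m} {m} ps (powersOfTwo-descending (suc m)) (∈bparts l∈L) ,
    All.map (proj₁ ∘ ∈-powersOfTwo⁻) (bparts-parts {m} {m} ps (∈bparts l∈L))
  unique : Unique L
  unique = Unique.filter⁺ P?
    (subst Unique (sym (𝓑≡bparts m)) (bparts-unique {m} {m} ps (powersOfTwo-descending (suc m))))

a≡binaryProduct : ∀ n → a n ≡ binaryProduct (downFrom (suc n)) (shift 2 δ) n
a≡binaryProduct n = trans (a≡pairsOfOnesSum n)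
  (trans (pairsOfOnesSum-diagonal n) (binaryProduct-comm (shift-isSI 2) (downFrom (suc n)) δ n))

n<2^1+n : ∀ n → n < 2 ^ suc n
n<2^1+n n = <-trans (n<1+n n) (n<2^n (suc n))

a+2≡binaryProduct : ∀ n → a (n + 2) ≡ binaryProduct (downFrom (suc n)) δ n
a+2≡binaryProduct n = begin
  a (n + 2)
    ≡⟨ a≡binaryProduct (n + 2) ⟩
  binaryProduct (downFrom (suc (n + 2))) (shift 2 δ) (n + 2)
    ≡⟨ binaryProduct-comm (shift-isSI 2) (downFrom (suc (n + 2))) δ (n + 2) ⟨
  shift 2 (binaryProduct (downFrom (suc (n + 2))) δ) (n + 2)
    ≡⟨ shift-≥ 2 _ (m≤n+m 2 n) ⟩
  binaryProduct (downFrom (suc (n + 2))) δ (n + 2 ∸ 2)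
    ≡⟨ cong (binaryProduct (downFrom (suc (n + 2))) δ) (m+n∸n≡m n 2) ⟩
  binaryProduct (downFrom (suc (n + 2))) δ n
    ≡⟨ binaryProduct-stable δ (s≤s (m≤m+n n 2)) (n<2^1+n n) ⟩
  binaryProduct (downFrom (suc n)) δ n ∎
  where open ≡-Reasoning

theorem4p1 : ((n N : ℕ) → n < N → a n ≡ coeff n (genTrunc N))
    × ((n : ℕ) → a (n + 2) ≡ Q n)
    × ((n : ℕ) → a (n + 2) ≡ binomSum n)
theorem4p1 =
  part-a ,
  (λ n → trans (a+2≡binaryProduct n) (sym (Q≡binaryProduct n))) ,
  (λ n → trans (a+2≡binaryProduct n) (sym (binomSum≡binaryProduct n)))
  where
  part-a : (n N : ℕ) → n < N → a n ≡ coeff n (genTrunc N)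
  part-a n N n<N = begin
    a n                                            ≡⟨ a≡binaryProduct n ⟩
    binaryProduct (downFrom (suc n)) (shift 2 δ) n ≡⟨ binaryProduct-stable (shift 2 δ) n<N (n<2^1+n n) ⟨
    binaryProduct (downFrom N) (shift 2 δ) n       ≡⟨ binaryProduct-comm (shift-isSI 2) (downFrom N) δ n ⟨
    shift 2 (binaryProduct (downFrom N) δ) n       ≡⟨ coeffs-genTrunc N n ⟨
    coeff n (genTrunc N)                           ∎
    where open ≡-Reasoning
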